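{- Let $P$ be a poset on $\{1,\ldots,n\}$ and let $J$ be a connected order ideal of $P$. Then the graph $\chi_J$ is connected.
   Context: An order ideal of $P$ is a subset $J$ with $i\in J$, $j\le_P i\Rightarrow j\in J$; a nonempty order ideal is connected if the Hasse diagram of $P$ restricted to it is connected. Sets $A,B$ intersect nontrivially if $A\cap B\ne\emptyset$, $A\not\subseteq B$, $B\not\subseteq A$. $G_P$ is the simple graph whose vertices are the connected order ideals of $P$, adjacent iff they intersect nontrivially. $\Lambda_i^P=\{k:k\le_P i\}$. $gs(J)$ is the set of maximal elements of $J$ under $\le_P$; if $gs(J)=\{i_1,\ldots,i_k\}$, $\chi_J$ is the subgraph of $G_P$ induced by $\{\Lambda_{i_1}^P,\ldots,\Lambda_{i_k}^P\}$. -}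

module Defs where

open import Data.Nat using (ℕ)
open import Data.Fin using (Fin)
open import Data.Fin.Subset using (Subset; _∈_; _⊆_; _∩_; Nonempty; ⁅_⁆)
open import Data.Product using (Σ; ∃; _×_; _,_)
open import Data.Sum using (_⊎_)
open import Data.Vec.Functional using ()
open import Data.Vec using (tabulate)
open import Relation.Nullary using (¬_; does)
open import Relation.Binary.PropositionalEquality using (_≡_)
open import Relation.Binary.Structures using (IsDecPartialOrder)

-- A (finite) poset P on {1,…,n}, modelled as Fin n with a decidable
-- partial order _≤P_ (w.r.t. propositional equality).
record FinPoset (n : ℕ) : Set₁ where
  field
    _≤P_ : Fin n → Fin n → Set
    isDecPartialOrder : IsDecPartialOrder _≡_ _≤P_

  open IsDecPartialOrder isDecPartialOrder public
    using () renaming (_≤?_ to _≤P?_)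

  _<P_ : Fin n → Fin n → Set
  i <P j = i ≤P j × ¬ (i ≡ j)

  _⋖_ : Fin n → Fin n → Set
  i ⋖ j = i <P j × ¬ (Σ (Fin n) λ k → i <P k × k <P j)

  HasseAdj : Fin n → Fin n → Set
  HasseAdj i j = i ⋖ j ⊎ j ⋖ i

  IsOrderIdeal : Subset n → Set
  IsOrderIdeal J = ∀ i j → i ∈ J → j ≤P i → j ∈ J

  data HassePath (J : Subset n) : Fin n → Fin n → Set where
    here : ∀ {i} → i ∈ J → HassePath J i i
    step : ∀ {i j k} → i ∈ J → HasseAdj i j → HassePath J j k → HassePath J i k

  IsConnectedOrderIdeal : Subset n → Set
  IsConnectedOrderIdeal J =
    Nonempty J × IsOrderIdeal J × (∀ i j → i ∈ J → j ∈ J → HassePath J i j)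

  NontrivInter : Subset n → Subset n → Set
  NontrivInter A B = Nonempty (A ∩ B) × ¬ (A ⊆ B) × ¬ (B ⊆ A)

  -- adjacency in G_P: both vertices are connected order ideals and they
  -- intersect nontrivially
  GAdj : Subset n → Subset n → Set
  GAdj A B = IsConnectedOrderIdeal A × IsConnectedOrderIdeal B × NontrivInter A B

  Λ : Fin n → Subset n
  Λ i = tabulate λ k → does (k ≤P? i)

  IsMaximalIn : Subset n → Fin n → Set
  IsMaximalIn J i = i ∈ J × (∀ j → j ∈ J → i ≤P j → j ≡ i)

  ChiVertex : Subset n → Subset n → Set
  ChiVertex J A = Σ (Fin n) λ i → IsMaximalIn J i × A ≡ Λ i

module _ {A : Set} (V : A → Set) (E : A → A → Set) where
  data Walk : A → A → Set where
    here : ∀ {x} → V x → Walk x x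
    step : ∀ {x y z} → V x → E x y → Walk y z → Walk x z

  IsConnectedGraph : Set
  IsConnectedGraph = (Σ A V) × (∀ x y → V x → V y → Walk x y)

-- "χ_J is connected", where χ_J is the subgraph of G_P induced by {Λ_i : i ∈ gs(J)}
χ-isConnected : ∀ {n} (P : FinPoset n) → Subset n → Set
χ-isConnected P J = IsConnectedGraph (ChiVertex J) GAdj
  where open FinPoset P

-- Every maximal element of J lies in J, and any two elements of J are joined
-- by a Hasse path inside J.  Walking along that path, choose for every vertex
-- a maximal element of J above it.  Two consecutive vertices are comparable,
-- so the lower one lies below both chosen maxima, whose principal ideals
-- therefore meet; distinct maximal elements have incomparable principal
-- ideals, so consecutive ideals are equal or adjacent in χ_J.
module Submission where

open import Defs
open import Data.Nat using (ℕ)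
open import Data.Fin using (Fin; _≟_)
open import Data.Fin.Subset using (Subset; _∈_; _⊆_)
open import Data.Fin.Subset.Properties using (_∈?_; x∈p∩q⁺)
open import Data.Fin.Properties using (any?)
open import Data.Fin.Induction using (po-wellFounded; po-noetherian)
open import Data.Vec.Properties using (lookup∘tabulate; []=⇒lookup; lookup⇒[]=)
open import Data.Empty using (⊥-elim)
open import Data.Product using (Σ; _×_; _,_; proj₁)
open import Data.Sum using (_⊎_; inj₁; inj₂)
open import Relation.Nullary using (does; yes; no; _×-dec_)
open import Relation.Nullary.Decidable using (dec-true)
open import Relation.Binary.Definitions using (Decidable)
open import Relation.Binary.PropositionalEquality using (_≡_; refl; sym; trans)
open import Relation.Binary.Structures using (IsDecPartialOrder)
open import Relation.Binary.Construct.NonStrictToStrict using (<-decidable)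
open import Induction.WellFounded using (Acc; acc)

module Properties {n : ℕ} (P : FinPoset n) where
  open FinPoset P
  open IsDecPartialOrder isDecPartialOrder
    using (isPartialOrder) renaming (refl to ≤-refl; trans to ≤-trans)

  _<P?_ : Decidable _<P_
  _<P?_ = <-decidable _≡_ _≤P_ _≟_ _≤P?_

  ≤⇒∈Λ : ∀ {k i} → k ≤P i → k ∈ Λ i
  ≤⇒∈Λ {k} {i} k≤i = lookup⇒[]= k (Λ i)
    (trans (lookup∘tabulate (λ k → does (k ≤P? i)) k) (dec-true (k ≤P? i) k≤i))

  ∈Λ⇒≤ : ∀ {k i} → k ∈ Λ i → k ≤P i
  ∈Λ⇒≤ {k} {i} k∈Λi
    with k ≤P? i | trans (sym (lookup∘tabulate (λ k → does (k ≤P? i)) k)) ([]=⇒lookup k∈Λi)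
  ... | yes k≤i | _ = k≤i
  ... | no _    | ()

  HasseAdj-sym : ∀ {i j} → HasseAdj i j → HasseAdj j i
  HasseAdj-sym (inj₁ i⋖j) = inj₂ i⋖j
  HasseAdj-sym (inj₂ j⋖i) = inj₁ j⋖i

  HasseAdj⇒comparable : ∀ {i j} → HasseAdj i j → i ≤P j ⊎ j ≤P i
  HasseAdj⇒comparable (inj₁ ((i≤j , _) , _)) = inj₁ i≤j
  HasseAdj⇒comparable (inj₂ ((j≤i , _) , _)) = inj₂ j≤i

  HasseAdj⇒lowerBound : ∀ {x y a b} → HasseAdj x y → x ≤P a → y ≤P b →
                        Σ (Fin n) λ c → c ≤P a × c ≤P b
  HasseAdj⇒lowerBound {x} {y} x~y x≤a y≤b with HasseAdj⇒comparable x~y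
  ... | inj₁ x≤y = x , x≤a , ≤-trans x≤y y≤b
  ... | inj₂ y≤x = y , ≤-trans y≤x x≤a , y≤b

  module _ {J : Subset n} where

    source∈ : ∀ {i j} → HassePath J i j → i ∈ J
    source∈ (here i∈J)     = i∈J
    source∈ (step i∈J _ _) = i∈J

    _++ᴴ_ : ∀ {i j k} → HassePath J i j → HassePath J j k → HassePath J i k
    here _       ++ᴴ q = q
    step i∈J e p ++ᴴ q = step i∈J e (p ++ᴴ q)

    reverseᴴ : ∀ {i j} → HassePath J i j → HassePath J j i
    reverseᴴ p = go p (here (source∈ p))
      where
      go : ∀ {i j k} → HassePath J i j → HassePath J i k → HassePath J j k
      go (here _)     q = q
      go (step _ e p) q = go p (step (source∈ p) (HasseAdj-sym e) q)

  maximal-above : ∀ (J : Subset n) x → x ∈ J → Acc (λ a b → b <P a) x →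
                  Σ (Fin n) λ m → IsMaximalIn J m × x ≤P m
  maximal-above J x x∈J (acc rec) with any? (λ y → (y ∈? J) ×-dec (x <P? y))
  ... | yes (y , y∈J , x<y) =
    let m , m-max , y≤m = maximal-above J y y∈J (rec x<y)
    in  m , m-max , ≤-trans (proj₁ x<y) y≤m
  ... | no ¬bigger = x , (x∈J , maximal) , ≤-refl
    where
    maximal : ∀ j → j ∈ J → x ≤P j → j ≡ x
    maximal j j∈J x≤j with j ≟ x
    ... | yes j≡x = j≡x
    ... | no  j≢x = ⊥-elim (¬bigger (j , j∈J , x≤j , λ x≡j → j≢x (sym x≡j)))

  ⋖-below : ∀ j k → Acc _<P_ k → j <P k → Σ (Fin n) λ c → j ⋖ c × c ≤P k
  ⋖-below j k (acc rec) j<k with any? (λ c → (j <P? c) ×-dec (c <P? k))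
  ... | yes (c , j<c , c<k) =
    let d , j⋖d , d≤c = ⋖-below j c (rec c<k) j<c
    in  d , j⋖d , ≤-trans d≤c (proj₁ c<k)
  ... | no ¬between = k , (j<k , ¬between) , ≤-refl

  hassePath-up : ∀ i j → Acc (λ a b → b <P a) j → j ≤P i → HassePath (Λ i) j i
  hassePath-up i j (acc rec) j≤i with j ≟ i
  ... | yes refl = here (≤⇒∈Λ ≤-refl)
  ... | no  j≢i  =
    let c , j⋖c , c≤i = ⋖-below j i (po-wellFounded isPartialOrder i) (j≤i , j≢i)
    in  step (≤⇒∈Λ j≤i) (inj₁ j⋖c) (hassePath-up i c (rec (proj₁ j⋖c)) c≤i)

  Λ-isConnectedOrderIdeal : ∀ i → IsConnectedOrderIdeal (Λ i)
  Λ-isConnectedOrderIdeal i =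
      (i , ≤⇒∈Λ ≤-refl)
    , (λ j k j∈Λi k≤j → ≤⇒∈Λ (≤-trans k≤j (∈Λ⇒≤ j∈Λi)))
    , λ j k j∈Λi k∈Λi → up j j∈Λi ++ᴴ reverseᴴ (up k k∈Λi)
    where
    up : ∀ j → j ∈ Λ i → HassePath (Λ i) j i
    up j j∈Λi = hassePath-up i j (po-noetherian isPartialOrder j) (∈Λ⇒≤ j∈Λi)

  Λ⊆Λ⇒≡ : ∀ {J a b} → IsMaximalIn J a → b ∈ J → Λ a ⊆ Λ b → b ≡ a
  Λ⊆Λ⇒≡ (_ , a-max) b∈J Λa⊆Λb = a-max _ b∈J (∈Λ⇒≤ (Λa⊆Λb (≤⇒∈Λ ≤-refl)))

  module _ (J : Subset n) where

    χ-Walk : Subset n → Subset n → Set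
    χ-Walk = Walk (ChiVertex J) GAdj

    χ-prepend : ∀ {a b c Z} → IsMaximalIn J a → IsMaximalIn J b →
                c ≤P a → c ≤P b → χ-Walk (Λ b) Z → χ-Walk (Λ a) Z
    χ-prepend {a} {b} {c} a-max b-max c≤a c≤b w with a ≟ b
    ... | yes refl = w
    ... | no  a≢b  = step (a , a-max , refl) Λa~Λb w
      where
      Λa~Λb : GAdj (Λ a) (Λ b)
      Λa~Λb = Λ-isConnectedOrderIdeal a
            , Λ-isConnectedOrderIdeal b
            , (c , x∈p∩q⁺ (≤⇒∈Λ c≤a , ≤⇒∈Λ c≤b))
            , (λ ⊆ → a≢b (sym (Λ⊆Λ⇒≡ a-max (proj₁ b-max) ⊆)))
            , (λ ⊆ → a≢b (Λ⊆Λ⇒≡ b-max (proj₁ a-max) ⊆))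

    χ-walk-along : ∀ {x j a} → HassePath J x j → IsMaximalIn J j →
                   IsMaximalIn J a → x ≤P a → χ-Walk (Λ a) (Λ j)
    χ-walk-along {j = j} (here _) j-max a-max j≤a =
      χ-prepend a-max j-max j≤a ≤-refl (here (j , j-max , refl))
    χ-walk-along (step {j = y} _ x~y p) j-max a-max x≤a
      with maximal-above J y (source∈ p) (po-noetherian isPartialOrder y)
    ... | b , b-max , y≤b =
      let c , c≤a , c≤b = HasseAdj⇒lowerBound x~y x≤a y≤b
      in  χ-prepend a-max b-max c≤a c≤b (χ-walk-along p j-max b-max y≤b)

lemma3p1 : (n : ℕ) (P : FinPoset n) (J : Subset n) →
    FinPoset.IsConnectedOrderIdeal P J → χ-isConnected P J
lemma3p1 n P J ((x , x∈J) , _ , hassePath) =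
  let m , m-max , _ = maximal-above J x x∈J (po-noetherian isPartialOrder x)
  in  (Λ m , m , m-max , refl) , walk
  where
  open FinPoset P
  open IsDecPartialOrder isDecPartialOrder using (isPartialOrder) renaming (refl to ≤-refl)
  open Properties P

  walk : ∀ A B → ChiVertex J A → ChiVertex J B → χ-Walk J A B
  walk _ _ (i , i-max , refl) (j , j-max , refl) =
    χ-walk-along J (hassePath i j (proj₁ i-max) (proj₁ j-max)) j-max i-max ≤-refl
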